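{- Let $q$ be a power of a prime $p$ and let $n$ be an odd positive integer with $\gcd(n,q)=1$. The multiplier $\mu_{ -q}$ gives a splitting of $n$ over $\mathbb{F}_{q^2}$ if and only if $\mathrm{ord}_r(q)\not\equiv 2\pmod 4$ for every prime $r$ dividing $n$.
   Context: $\mathrm{ord}_r(q)$ is the smallest positive integer $t$ with $q^t\equiv1\pmod r$. The $q^2$-cyclotomic coset of $s$ modulo $n$ is $\{s(q^2)^j\bmod n:j\ge0\}$. For $\gcd(b,n)=1$, $\mu_b$ gives a splitting of $n$ over $\mathbb{F}_{q^2}$ if there are sets $S_1,S_2$, each a union of $q^2$-cyclotomic cosets modulo $n$, with $S_1\cup S_2=\{1,\dots,n-1\}$, $S_1\cap S_2=\emptyset$, $bS_1\equiv S_2$ and $bS_2\equiv S_1\pmod n$. -}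

module Defs where

open import Data.Nat using (ℕ; zero; suc; _+_; _*_; _∸_; _^_; _<_; _≤_; NonZero)
open import Data.Nat.DivMod using (_mod_)
open import Data.Nat.Divisibility using (_∣_)
open import Data.Nat.Primality using (Prime)
open import Data.Integer as ℤ using (ℤ; +_)
open import Data.Integer.DivMod using (_%ℕ_)
open import Data.Fin using (Fin; toℕ)
open import Data.Fin.Subset using (Subset; _∈_; _∉_)
open import Data.Product using (Σ; ∃; ∃-syntax; _×_)
open import Data.Sum using (_⊎_)
open import Function.Bundles using (_⇔_)
open import Relation.Binary.PropositionalEquality using (_≡_; _≢_)
open import Relation.Nullary using (¬_)

IsPrimePowerOf : ℕ → ℕ → Set
IsPrimePowerOf p q = Prime p × ∃[ k ] (1 ≤ k × q ≡ p ^ k)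

-- ord_r(q) = t : the smallest positive t with q^t ≡ 1 (mod r)
-- (congruence q^t ≡ 1 mod r written as r ∣ q^t ∸ 1; here q^t ≥ 1)
IsMultOrder : (r q t : ℕ) → Set
IsMultOrder r q t =
  0 < t × r ∣ (q ^ t ∸ 1) × (∀ u → 0 < u → r ∣ (q ^ u ∸ 1) → t ≤ u)

mulMod : (n : ℕ) .{{_ : NonZero n}} → ℤ → ℕ → Fin n
mulMod n b s = ((b ℤ.* + s) %ℕ n) mod n

UnionOfCosets : (n : ℕ) .{{_ : NonZero n}} → (q : ℕ) → Subset n → Set
UnionOfCosets n q S = ∀ (s : Fin n) → s ∈ S → ∀ (j : ℕ) →
  mulMod n (+ ((q ^ 2) ^ j)) (toℕ s) ∈ S

MapsOnto : (n : ℕ) .{{_ : NonZero n}} → ℤ → Subset n → Subset n → Set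
MapsOnto n b S T =
  (∀ (s : Fin n) → s ∈ S → mulMod n b (toℕ s) ∈ T) ×
  (∀ (t : Fin n) → t ∈ T → ∃[ s ] (s ∈ S × mulMod n b (toℕ s) ≡ t))

GivesSplitting : (n : ℕ) .{{_ : NonZero n}} → (q : ℕ) → ℤ → Set
GivesSplitting n q b = ∃[ S₁ ] ∃[ S₂ ]
  ( UnionOfCosets n q S₁ × UnionOfCosets n q S₂
  × (∀ (i : Fin n) → (toℕ i ≢ 0 ⇔ (i ∈ S₁ ⊎ i ∈ S₂)))
  × (∀ (i : Fin n) → ¬ (i ∈ S₁ × i ∈ S₂))
  × MapsOnto n b S₁ S₂ × MapsOnto n b S₂ S₁ )

-- Write Q = q². As gcd(n, q) = 1, multiplication by Q permutes the residues modulo n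
-- with some period P, and the q²-cyclotomic cosets are its orbits. If b² ≡ Qᶜ (mod n), as
-- for b = -q, then μ_b permutes the cosets and μ_b² fixes each of them, so the nonzero
-- cosets come in pairs {C, bC}. Hence μ_b gives a splitting iff no nonzero coset satisfies
-- bC = C: if none does, let S₁ (resp. S₂) collect the nonzero s whose coset leader
-- (least element) is smaller (resp. larger) than that of bs; if bs ∈ C(s) with s ≠ 0,
-- then s can lie in neither half.
--
-- For b = -q, the congruence -qs ≡ Q^(a+1) s says n ∣ q (q^(2a+1) + 1) s, i.e.
-- n ∣ (q^(2a+1) + 1) s. For some 0 < s < n this happens iff some prime r ∣ n divides
-- q^e + 1 with e odd (take s = n / r for one direction), and for the odd prime r this
-- means exactly that ord_r(q) ≡ 2 (mod 4): q^e ≡ -1 forces ord_r(q) ∣ 2e but not ∣ e,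
-- while ord_r(q) = 2e forces q^e ≡ -1.

module Submission where

open import Defs
open import Data.Nat using (ℕ; _%_; NonZero)
open import Data.Nat.Divisibility using (_∣_)
open import Data.Nat.GCD using (gcd)
open import Data.Nat.Primality using (Prime)
open import Data.Integer using (-_; +_)
open import Function.Bundles using (_⇔_)
open import Relation.Binary.PropositionalEquality using (_≡_; _≢_)

open import Data.Nat
  using (zero; suc; pred; _+_; _*_; _^_; _∸_; _/_; _⊓_; _≤_; _<_; z≤n; s≤s; z<s
        ; >-nonZero; ≢-nonZero; ≢-nonZero⁻¹; nonTrivial⇒n>1)
open import Data.Nat.Properties
open import Data.Nat.Divisibility
  using ( divides; ∣-trans; n∣m⇒m%n≡0; m%n≡0⇒n∣m; ∣⇒≤; *-cancelˡ-∣; *-cancelʳ-∣; *-monoˡ-∣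
        ; m∣m*n; n∣m*n; ∣1⇒≡1; _∣?_)
open import Data.Nat.DivMod using (m≡m%n+[m/n]*n; m<n⇒m%n≡m; m%n<n; m%n*o≡m*o%[n*o]; [m+kn]%n≡m%n)
open import Data.Nat.GCD using (gcd[m,n]∣m; gcd[m,n]∣n; gcd[m,n]≢0)
open import Data.Nat.Coprimality using (Coprime; coprime?; coprime-divisor; gcd≡1⇒coprime)
open import Data.Nat.Primality using (euclidsLemma; prime[2]; prime⇒nonZero; prime⇒nonTrivial)
open import Data.Nat.Primality.Factorisation using (factorise; PrimeFactorisation)
open PrimeFactorisation using (factors; isFactorisation; factorsPrime)
open import Data.Nat.ListAction using (product)
open import Data.Nat.Induction using (<-rec)
import Data.Nat.Tactic.RingSolver as ℕ-Solver
open import Data.Integer as ℤ using (ℤ; 0ℤ; 1ℤ)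
import Data.Integer.Properties as ℤ
import Data.Integer.DivMod as ℤ
open import Data.Integer.Divisibility.Signed as ℤ∣ using () renaming (_∣_ to _∣ℤ_)
open import Data.Integer.Tactic.RingSolver using (solve-∀)
open import Data.Fin using (Fin; toℕ; fromℕ<)
open import Data.Fin.Properties using (toℕ-injective; toℕ<n; toℕ-fromℕ<; pigeonhole; any?)
open import Data.Fin.Subset using (Subset; _∈_)
open import Data.Vec using (tabulate)
open import Data.Vec.Properties using (lookup∘tabulate; lookup⇒[]=; []=⇒lookup)
open import Data.List using ([]; _∷_)
open import Data.List.Relation.Unary.All using (All; _∷_)
open import Data.Product using (∃-syntax; _×_; _,_; proj₁; proj₂)
open import Data.Sum using (_⊎_; inj₁; inj₂; map₁; [_,_]′)
open import Data.Empty using (⊥-elim)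
open import Function using (_∘_; flip; id)
open import Function.Bundles using (mk⇔; Equivalence)
open import Function.Properties.Equivalence using () renaming (trans to ⇔-trans)
open import Relation.Binary using (Rel; Setoid; Decidable; tri<; tri≈; tri>)
open import Relation.Binary.PropositionalEquality
  using (refl; sym; trans; cong; subst; subst₂; module ≡-Reasoning)
open import Relation.Nullary using (¬_; ¬?; Dec; yes; no; does; contradiction)
open import Relation.Nullary.Decidable using (_×-dec_; dec-true)
open import Level using (0ℓ)
import Relation.Binary.Reasoning.Setoid as SetoidReasoning

infix 4 _≡_mod_

-- Congruences modulo m

-- A record rather than a definition, so that a and b can be inferred from a proof.
record _≡_mod_ (a b : ℤ) (m : ℕ) : Set where
  constructor ∣⇒≡mod
  field ≡mod⇒∣ : + m ∣ℤ a ℤ.- b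

open _≡_mod_

module _ {m : ℕ} where

  ≡mod-resp-diff : ∀ {a b c d} → a ℤ.- b ≡ c ℤ.- d → a ≡ b mod m → c ≡ d mod m
  ≡mod-resp-diff eq (∣⇒≡mod m∣a-b) = ∣⇒≡mod (subst (+ m ∣ℤ_) eq m∣a-b)

  ≡⇒≡mod : ∀ {a b} → a ≡ b → a ≡ b mod m
  ≡⇒≡mod {a} refl =
    ∣⇒≡mod (ℤ∣.divides 0ℤ (trans (ℤ.+-inverseʳ a) (sym (ℤ.*-zeroˡ (+ m)))))

  ≡mod-refl : ∀ {a} → a ≡ a mod m
  ≡mod-refl = ≡⇒≡mod refl

  ≡mod-sym : ∀ {a b} → a ≡ b mod m → b ≡ a mod m
  ≡mod-sym {a} {b} (∣⇒≡mod m∣a-b) =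
    ∣⇒≡mod (subst (+ m ∣ℤ_) (negate-diff a b) (ℤ∣.∣m⇒∣-m m∣a-b))
    where
    negate-diff : ∀ a b → ℤ.- (a ℤ.- b) ≡ b ℤ.- a
    negate-diff = solve-∀

  ≡mod-trans : ∀ {a b c} → a ≡ b mod m → b ≡ c mod m → a ≡ c mod m
  ≡mod-trans {a} {b} {c} (∣⇒≡mod m∣a-b) (∣⇒≡mod m∣b-c) =
    ∣⇒≡mod (subst (+ m ∣ℤ_) (telescope a b c) (ℤ∣.∣m∣n⇒∣m+n m∣a-b m∣b-c))
    where
    telescope : ∀ a b c → (a ℤ.- b) ℤ.+ (b ℤ.- c) ≡ a ℤ.- c
    telescope = solve-∀

  +-cong-≡mod : ∀ {a b c d} → a ≡ b mod m → c ≡ d mod m → a ℤ.+ c ≡ b ℤ.+ d mod m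
  +-cong-≡mod {a} {b} {c} {d} (∣⇒≡mod m∣a-b) (∣⇒≡mod m∣c-d) =
    ∣⇒≡mod (subst (+ m ∣ℤ_) (regroup a b c d) (ℤ∣.∣m∣n⇒∣m+n m∣a-b m∣c-d))
    where
    regroup : ∀ a b c d → (a ℤ.- b) ℤ.+ (c ℤ.- d) ≡ (a ℤ.+ c) ℤ.- (b ℤ.+ d)
    regroup = solve-∀

  *-congˡ-≡mod : ∀ c {a b} → a ≡ b mod m → c ℤ.* a ≡ c ℤ.* b mod m
  *-congˡ-≡mod c {a} {b} (∣⇒≡mod m∣a-b) =
    ∣⇒≡mod (subst (+ m ∣ℤ_) (distrib c a b) (ℤ∣.∣n⇒∣m*n c m∣a-b))
    where
    distrib : ∀ c a b → c ℤ.* (a ℤ.- b) ≡ c ℤ.* a ℤ.- c ℤ.* b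
    distrib = solve-∀

  *-cong-≡mod : ∀ {a b c d} → a ≡ b mod m → c ≡ d mod m → a ℤ.* c ≡ b ℤ.* d mod m
  *-cong-≡mod {a} {b} {c} {d} a≡b c≡d = ≡mod-trans
    (subst₂ (_≡_mod m) (ℤ.*-comm c a) (ℤ.*-comm c b) (*-congˡ-≡mod c a≡b))
    (*-congˡ-≡mod b c≡d)

≡mod-setoid : ℕ → Setoid 0ℓ 0ℓ
≡mod-setoid m = record
  { Carrier       = ℤ
  ; _≈_           = _≡_mod m
  ; isEquivalence = record { refl = ≡mod-refl ; sym = ≡mod-sym ; trans = ≡mod-trans }
  }

module ≡mod-Reasoning (m : ℕ) = SetoidReasoning (≡mod-setoid m)

module _ {m : ℕ} where

  private
    pos-diff : ∀ {x y} → y ≤ x → + x ℤ.- + y ≡ + (x ∸ y)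
    pos-diff {x} {y} y≤x = trans (ℤ.m-n≡m⊖n x y) (ℤ.⊖-≥ y≤x)

    ∣ℤ⇒≡0 : ∀ {a} → + m ∣ℤ a → a ≡ 0ℤ mod m
    ∣ℤ⇒≡0 {a} m∣a = ∣⇒≡mod (subst (+ m ∣ℤ_) (sym (ℤ.+-identityʳ a)) m∣a)

    ≡0⇒∣ℤ : ∀ {a} → a ≡ 0ℤ mod m → + m ∣ℤ a
    ≡0⇒∣ℤ {a} (∣⇒≡mod m∣a-0) = subst (+ m ∣ℤ_) (ℤ.+-identityʳ a) m∣a-0

  ∣∸⇒≡mod : ∀ {x y} → y ≤ x → m ∣ x ∸ y → + x ≡ + y mod m
  ∣∸⇒≡mod y≤x m∣x∸y = ∣⇒≡mod (subst (+ m ∣ℤ_) (sym (pos-diff y≤x)) (ℤ∣.∣ᵤ⇒∣ m∣x∸y))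

  ≡mod⇒∣∸ : ∀ {x y} → y ≤ x → + x ≡ + y mod m → m ∣ x ∸ y
  ≡mod⇒∣∸ y≤x (∣⇒≡mod m∣x-y) = ℤ∣.∣⇒∣ᵤ (subst (+ m ∣ℤ_) (pos-diff y≤x) m∣x-y)

  *-cancelˡ-≡mod : ∀ {c} → Coprime m c → ∀ {a b} → + c ℤ.* a ≡ + c ℤ.* b mod m → a ≡ b mod m
  *-cancelˡ-≡mod {c} m⊥c {a} {b} (∣⇒≡mod m∣ca-cb) =
    ∣⇒≡mod (ℤ∣.∣ᵤ⇒∣ (coprime-divisor m⊥c m∣c*∣a-b∣))
    where
    factor : ∀ c a b → c ℤ.* a ℤ.- c ℤ.* b ≡ c ℤ.* (a ℤ.- b)
    factor = solve-∀
    m∣c*∣a-b∣ : m ∣ c * ℤ.∣ a ℤ.- b ∣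
    m∣c*∣a-b∣ = subst (m ∣_) (ℤ.abs-* (+ c) (a ℤ.- b))
                  (ℤ∣.∣⇒∣ᵤ (subst (+ m ∣ℤ_) (factor (+ c) a b) m∣ca-cb))

  euclidsLemma-≡mod : Prime m → ∀ {a b} → a ℤ.* b ≡ 0ℤ mod m → a ≡ 0ℤ mod m ⊎ b ≡ 0ℤ mod m
  euclidsLemma-≡mod m-prime {a} {b} ab≡0
    with euclidsLemma ℤ.∣ a ∣ ℤ.∣ b ∣ m-prime
           (subst (m ∣_) (ℤ.abs-* a b) (ℤ∣.∣⇒∣ᵤ (≡0⇒∣ℤ ab≡0)))
  ... | inj₁ m∣a = inj₁ (∣ℤ⇒≡0 (ℤ∣.∣ᵤ⇒∣ m∣a))
  ... | inj₂ m∣b = inj₂ (∣ℤ⇒≡0 (ℤ∣.∣ᵤ⇒∣ m∣b))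

  ∣+1⇒+1≡0 : ∀ {x} → m ∣ x + 1 → + x ℤ.+ 1ℤ ≡ 0ℤ mod m
  ∣+1⇒+1≡0 {x} m∣x+1 = subst (_≡ 0ℤ mod m) (ℤ.pos-+ x 1) (∣∸⇒≡mod {x + 1} {0} z≤n m∣x+1)

  +1≡0⇒∣+1 : ∀ {x} → + x ℤ.+ 1ℤ ≡ 0ℤ mod m → m ∣ x + 1
  +1≡0⇒∣+1 {x} x+1≡0 = ≡mod⇒∣∸ {x + 1} {0} z≤n (subst (_≡ 0ℤ mod m) (sym (ℤ.pos-+ x 1)) x+1≡0)

  x²≡1⇒x≡±1 : Prime m → ∀ {x} → x ℤ.* x ≡ 1ℤ mod m → x ≡ 1ℤ mod m ⊎ x ℤ.+ 1ℤ ≡ 0ℤ mod m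
  x²≡1⇒x≡±1 m-prime {x} x²≡1 = map₁ x-1≡0⇒x≡1 (euclidsLemma-≡mod m-prime [x-1][x+1]≡0)
    where
    open ≡mod-Reasoning m
    factor : ∀ x → (x ℤ.- 1ℤ) ℤ.* (x ℤ.+ 1ℤ) ≡ x ℤ.* x ℤ.- 1ℤ
    factor = solve-∀
    [x-1][x+1]≡0 : (x ℤ.- 1ℤ) ℤ.* (x ℤ.+ 1ℤ) ≡ 0ℤ mod m
    [x-1][x+1]≡0 = begin
      (x ℤ.- 1ℤ) ℤ.* (x ℤ.+ 1ℤ)   ≡⟨ factor x ⟩
      x ℤ.* x ℤ.- 1ℤ              ≈⟨ +-cong-≡mod x²≡1 (≡mod-refl {a = ℤ.- 1ℤ}) ⟩
      1ℤ ℤ.- 1ℤ                   ≡⟨ ℤ.+-inverseʳ 1ℤ ⟩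
      0ℤ                          ∎
    x-1≡0⇒x≡1 : x ℤ.- 1ℤ ≡ 0ℤ mod m → x ≡ 1ℤ mod m
    x-1≡0⇒x≡1 = ≡mod-resp-diff (ℤ.+-identityʳ (x ℤ.- 1ℤ))

  ≡1⇒^≡1 : ∀ {x} → + x ≡ 1ℤ mod m → ∀ k → + (x ^ k) ≡ 1ℤ mod m
  ≡1⇒^≡1 x≡1 zero    = ≡mod-refl
  ≡1⇒^≡1 {x} x≡1 (suc k) =
    subst (_≡ 1ℤ mod m) (sym (ℤ.pos-* x (x ^ k))) (*-cong-≡mod x≡1 (≡1⇒^≡1 x≡1 k))

  ^≡1⇒^-multiple≡1 : ∀ {x t w} → + (x ^ t) ≡ 1ℤ mod m → t ∣ w → + (x ^ w) ≡ 1ℤ mod m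
  ^≡1⇒^-multiple≡1 {x} {t} x^t≡1 (divides k refl) =
    subst (λ e → + e ≡ 1ℤ mod m) (trans (^-*-assoc x t k) (cong (x ^_) (*-comm t k)))
      (≡1⇒^≡1 x^t≡1 k)

pos-^-+ : ∀ x i j → + (x ^ (i + j)) ≡ + (x ^ i) ℤ.* + (x ^ j)
pos-^-+ x i j = trans (cong +_ (^-distribˡ-+-* x i j)) (ℤ.pos-* (x ^ i) (x ^ j))

-- Residues modulo n

toℤ : ∀ {n} → Fin n → ℤ
toℤ s = + toℕ s

∣∧<⇒≡0 : ∀ {n m} .{{_ : NonZero n}} → n ∣ m → m < n → m ≡ 0
∣∧<⇒≡0 {n} {m} n∣m m<n = trans (sym (m<n⇒m%n≡m m<n)) (n∣m⇒m%n≡0 m n n∣m)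

module _ {n : ℕ} .{{_ : NonZero n}} where

  infixr 7 _·_

  _·_ : ℤ → Fin n → Fin n
  a · s = mulMod n a (toℕ s)

  toℤ-mulMod : ∀ a x → toℤ (mulMod n a x) ≡ a ℤ.* + x mod n
  toℤ-mulMod a x = ≡mod-sym (∣⇒≡mod (ℤ∣.divides (y ℤ./ℕ n) y-r≡k*n))
    where
    y = a ℤ.* + x
    r = y ℤ.%ℕ n
    toℕ[mulMod]≡r : toℕ (mulMod n a x) ≡ r
    toℕ[mulMod]≡r = trans (toℕ-fromℕ< _) (m<n⇒m%n≡m (ℤ.n%ℕd<d y n))
    cancel-r : ∀ r k → (r ℤ.+ k) ℤ.- r ≡ k
    cancel-r = solve-∀
    y-r≡k*n : y ℤ.- toℤ (mulMod n a x) ≡ (y ℤ./ℕ n) ℤ.* + n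
    y-r≡k*n rewrite toℕ[mulMod]≡r =
      trans (cong (ℤ._- + r) (ℤ.a≡a%ℕn+[a/ℕn]*n y n)) (cancel-r (+ r) _)

  toℤ-· : ∀ a s → toℤ (a · s) ≡ a ℤ.* toℤ s mod n
  toℤ-· a s = toℤ-mulMod a (toℕ s)

  private
    ≤-of-≡mod : ∀ {i j : Fin n} → toℕ i ≤ toℕ j → toℤ j ≡ toℤ i mod n → toℕ j ≤ toℕ i
    ≤-of-≡mod {i} {j} i≤j j≡i = m∸n≡0⇒m≤n
      (∣∧<⇒≡0 (≡mod⇒∣∸ i≤j j≡i) (≤-<-trans (m∸n≤m (toℕ j) (toℕ i)) (toℕ<n j)))

  ≡mod⇒≡ : ∀ {i j : Fin n} → toℤ i ≡ toℤ j mod n → i ≡ j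
  ≡mod⇒≡ {i} {j} i≡j with ≤-total (toℕ i) (toℕ j)
  ... | inj₁ i≤j = toℕ-injective (≤-antisym i≤j (≤-of-≡mod i≤j (≡mod-sym i≡j)))
  ... | inj₂ j≤i = toℕ-injective (≤-antisym (≤-of-≡mod j≤i i≡j) j≤i)

  ·≡·⇒≡mod : ∀ {a a′} s → a · s ≡ a′ · s → a ℤ.* toℤ s ≡ a′ ℤ.* toℤ s mod n
  ·≡·⇒≡mod {a} {a′} s a·s≡a′·s = begin
    a ℤ.* toℤ s     ≈⟨ toℤ-· a s ⟨
    toℤ (a · s)     ≡⟨ cong toℤ a·s≡a′·s ⟩
    toℤ (a′ · s)    ≈⟨ toℤ-· a′ s ⟩
    a′ ℤ.* toℤ s    ∎
    where open ≡mod-Reasoning n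

  ≡mod⇒·≡· : ∀ {a a′} s → a ℤ.* toℤ s ≡ a′ ℤ.* toℤ s mod n → a · s ≡ a′ · s
  ≡mod⇒·≡· {a} {a′} s as≡a′s = ≡mod⇒≡ (begin
    toℤ (a · s)     ≈⟨ toℤ-· a s ⟩
    a ℤ.* toℤ s     ≈⟨ as≡a′s ⟩
    a′ ℤ.* toℤ s    ≈⟨ toℤ-· a′ s ⟨
    toℤ (a′ · s)    ∎)
    where open ≡mod-Reasoning n

  ·-congˡ : ∀ {a a′} → a ≡ a′ mod n → ∀ s → a · s ≡ a′ · s
  ·-congˡ {a} {a′} a≡a′ s = ≡mod⇒·≡· {a} {a′} s (*-cong-≡mod a≡a′ ≡mod-refl)

  ·-assoc : ∀ a a′ s → a · (a′ · s) ≡ (a ℤ.* a′) · s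
  ·-assoc a a′ s = ≡mod⇒≡ (begin
    toℤ (a · (a′ · s))      ≈⟨ toℤ-· a (a′ · s) ⟩
    a ℤ.* toℤ (a′ · s)      ≈⟨ *-congˡ-≡mod a (toℤ-· a′ s) ⟩
    a ℤ.* (a′ ℤ.* toℤ s)    ≡⟨ ℤ.*-assoc a a′ (toℤ s) ⟨
    (a ℤ.* a′) ℤ.* toℤ s    ≈⟨ toℤ-· (a ℤ.* a′) s ⟨
    toℤ ((a ℤ.* a′) · s)    ∎)
    where open ≡mod-Reasoning n

  ·-identityˡ : ∀ s → 1ℤ · s ≡ s
  ·-identityˡ s = ≡mod⇒≡ (begin
    toℤ (1ℤ · s)    ≈⟨ toℤ-· 1ℤ s ⟩
    1ℤ ℤ.* toℤ s    ≡⟨ ℤ.*-identityˡ (toℤ s) ⟩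
    toℤ s           ∎)
    where open ≡mod-Reasoning n

  ·-zeroʳ : ∀ a {s} → toℕ s ≡ 0 → toℕ (a · s) ≡ 0
  ·-zeroʳ a {s} s≡0 = ∣∧<⇒≡0 (≡mod⇒∣∸ z≤n a·s≡0) (toℕ<n (a · s))
    where
    open ≡mod-Reasoning n
    a·s≡0 : toℤ (a · s) ≡ 0ℤ mod n
    a·s≡0 = begin
      toℤ (a · s)     ≈⟨ toℤ-· a s ⟩
      a ℤ.* toℤ s     ≡⟨ cong (λ x → a ℤ.* + x) s≡0 ⟩
      a ℤ.* 0ℤ        ≡⟨ ℤ.*-zeroʳ a ⟩
      0ℤ              ∎

coprime-^ : ∀ {n x} → Coprime n x → ∀ k → Coprime n (x ^ k)
coprime-^ n⊥x zero    (_ , d∣1)      = ∣1⇒≡1 d∣1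
coprime-^ n⊥x (suc k) (d∣n , d∣x*x^k) =
  coprime-^ n⊥x k (d∣n , coprime-divisor (λ (e∣d , e∣x) → n⊥x (∣-trans e∣d d∣n , e∣x)) d∣x*x^k)

coprime⇒∃x^P≡1 : ∀ {n x} .{{_ : NonZero n}} → Coprime n x → ∃[ P ] (0 < P × + (x ^ P) ≡ 1ℤ mod n)
coprime⇒∃x^P≡1 {n} {x} n⊥x with pigeonhole (n<1+n n) (λ (i : Fin (suc n)) → mulMod n (+ (x ^ toℕ i)) 1)
... | i , j , i<j , x^i≡x^j =
  toℕ j ∸ toℕ i , m<n⇒0<n∸m i<j , ≡mod-sym (*-cancelˡ-≡mod (coprime-^ n⊥x (toℕ i)) (begin
    + (x ^ toℕ i) ℤ.* 1ℤ                           ≈⟨ toℤ-mulMod (+ (x ^ toℕ i)) 1 ⟨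
    toℤ (mulMod n (+ (x ^ toℕ i)) 1)               ≡⟨ cong toℤ x^i≡x^j ⟩
    toℤ (mulMod n (+ (x ^ toℕ j)) 1)               ≈⟨ toℤ-mulMod (+ (x ^ toℕ j)) 1 ⟩
    + (x ^ toℕ j) ℤ.* 1ℤ                           ≡⟨ ℤ.*-identityʳ (+ (x ^ toℕ j)) ⟩
    + (x ^ toℕ j)                                  ≡⟨ cong (λ k → + (x ^ k)) (m+[n∸m]≡n (<⇒≤ i<j)) ⟨
    + (x ^ (toℕ i + (toℕ j ∸ toℕ i)))              ≡⟨ pos-^-+ x (toℕ i) (toℕ j ∸ toℕ i) ⟩
    + (x ^ toℕ i) ℤ.* + (x ^ (toℕ j ∸ toℕ i))      ∎))
  where open ≡mod-Reasoning n

select : ∀ {n} {P : Fin n → Set} → (∀ i → Dec (P i)) → Subset n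
select P? = tabulate (does ∘ P?)

module _ {n} {P : Fin n → Set} (P? : ∀ i → Dec (P i)) where

  ∈-select⁺ : ∀ {i} → P i → i ∈ select P?
  ∈-select⁺ {i} pi = lookup⇒[]= i (select P?) (trans (lookup∘tabulate _ i) (dec-true (P? i) pi))

  ∈-select⁻ : ∀ {i} → i ∈ select P? → P i
  ∈-select⁻ {i} i∈ with P? i | trans (sym ([]=⇒lookup i∈)) (lookup∘tabulate (does ∘ P?) i)
  ... | yes pi | _  = pi
  ... | no _   | ()

-- Elementary number theory

minUpTo : ℕ → (ℕ → ℕ) → ℕ
minUpTo zero    f = f zero
minUpTo (suc k) f = minUpTo k f ⊓ f (suc k)

minUpTo-≤ : ∀ {k j} f → j ≤ k → minUpTo k f ≤ f j
minUpTo-≤ {zero}  f z≤n = ≤-refl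
minUpTo-≤ {suc k} f j≤1+k with m≤n⇒m<n∨m≡n j≤1+k
... | inj₁ (s≤s j≤k) = ≤-trans (m⊓n≤m _ _) (minUpTo-≤ f j≤k)
... | inj₂ refl      = m⊓n≤n _ _

minUpTo-attained : ∀ k f → ∃[ j ] minUpTo k f ≡ f j
minUpTo-attained zero    f = zero , refl
minUpTo-attained (suc k) f with ⊓-sel (minUpTo k f) (f (suc k))
... | inj₂ min≡f[1+k] = suc k , min≡f[1+k]
... | inj₁ min≡min[k] with minUpTo-attained k f
...   | j , min[k]≡f[j] = j , trans min≡min[k] min[k]≡f[j]

Least : (ℕ → Set) → ℕ → Set
Least P t = P t × (∀ {u} → P u → t ≤ u)

least-witness : ∀ {P : ℕ → Set} → (∀ n → Dec (P n)) → ∀ {w} → P w → ∃[ t ] Least P t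
least-witness {P} P? {w} = <-rec (λ w → P w → ∃[ t ] Least P t) step w
  where
  step : ∀ w → (∀ {v} → v < w → P v → ∃[ t ] Least P t) → P w → ∃[ t ] Least P t
  step w smaller pw with any? (λ (i : Fin w) → P? (toℕ i))
  ... | yes (i , pi) = smaller (toℕ<n i) pi
  ... | no ∄i = w , pw , λ {u} pu →
    ≮⇒≥ (λ u<w → ∄i (fromℕ< u<w , subst P (sym (toℕ-fromℕ< u<w)) pu))

common-prime-factor : ∀ {n m s} → n ∣ m * s → 0 < s → s < n → ∃[ r ] (Prime r × r ∣ n × r ∣ m)
common-prime-factor {n} {m} {s} n∣ms 0<s s<n with coprime? n m
... | yes n⊥m = contradiction (∣⇒≤ {{>-nonZero 0<s}} (coprime-divisor n⊥m n∣ms)) (<⇒≱ s<n)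
... | no ¬n⊥m = first-factor (factors (factorise g)) (isFactorisation (factorise g))
                  (factorsPrime (factorise g))
  where
  g = gcd n m
  instance
    g≢0 : NonZero g
    g≢0 = ≢-nonZero (gcd[m,n]≢0 n m (inj₁ λ n≡0 → <⇒≱ s<n (subst (_≤ s) (sym n≡0) z≤n)))
  first-factor : ∀ ps → g ≡ product ps → All Prime ps → ∃[ r ] (Prime r × r ∣ n × r ∣ m)
  first-factor []      g≡1         _               = ⊥-elim (¬n⊥m (gcd≡1⇒coprime g≡1))
  first-factor (r ∷ _) g≡r*product (r-prime ∷ _) =
    r , r-prime , ∣-trans r∣g (gcd[m,n]∣m n m) , ∣-trans r∣g (gcd[m,n]∣n n m)
    where
    r∣g : r ∣ g
    r∣g = subst (r ∣_) (sym g≡r*product) (m∣m*n _)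

2∤odd : ∀ a → ¬ 2 ∣ suc (2 * a)
2∤odd a (divides c 1+2a≡c*2) = even≢odd c a (trans (*-comm 2 c) (sym 1+2a≡c*2))

%2≡1⇒2∤ : ∀ {k} → k % 2 ≡ 1 → ¬ 2 ∣ k
%2≡1⇒2∤ {k} k%2≡1 2∣k with trans (sym (n∣m⇒m%n≡0 k 2 2∣k)) k%2≡1
... | ()

∤⇒%2≡1 : ∀ {k} → ¬ 2 ∣ k → k % 2 ≡ 1
∤⇒%2≡1 {k} 2∤k with k % 2 in eq | m%n<n k 2
... | 0           | _   = contradiction (m%n≡0⇒n∣m k 2 eq) 2∤k
... | 1           | _   = refl
... | suc (suc _) | s≤s (s≤s ())

%4≡2⇒≡2*odd : ∀ {t} → t % 4 ≡ 2 → t ≡ 2 * suc (2 * (t / 4))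
%4≡2⇒≡2*odd {t} t%4≡2 = begin
  t                      ≡⟨ m≡m%n+[m/n]*n t 4 ⟩
  t % 4 + t / 4 * 4      ≡⟨ cong (_+ t / 4 * 4) t%4≡2 ⟩
  2 + t / 4 * 4          ≡⟨ shape (t / 4) ⟩
  2 * suc (2 * (t / 4))  ∎
  where
  open ≡-Reasoning
  shape : ∀ a → 2 + a * 4 ≡ 2 * suc (2 * a)
  shape = ℕ-Solver.solve-∀

∣2m∧∤m⇒%4≡2 : ∀ {t m} → t ∣ 2 * m → ¬ t ∣ m → ¬ 2 ∣ m → t % 4 ≡ 2
∣2m∧∤m⇒%4≡2 {t} {m} t∣2m@(divides a 2m≡a*t) t∤m 2∤m
  with euclidsLemma a t prime[2] (subst (2 ∣_) 2m≡a*t (m∣m*n m))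
... | inj₁ (divides a′ a≡a′*2) =
  contradiction
    (*-cancelˡ-∣ 2 (divides a′ (trans 2m≡a*t (trans (cong (_* t) a≡a′*2) (*-assoc a′ 2 t))))) t∤m
... | inj₂ (divides k t≡k*2) = begin
  t % 4           ≡⟨ cong (_% 4) t≡k*2 ⟩
  (k * 2) % 4     ≡⟨ m%n*o≡m*o%[n*o] k 2 2 ⟨
  (k % 2) * 2     ≡⟨ cong (_* 2) (∤⇒%2≡1 (λ 2∣k → 2∤m (∣-trans 2∣k k∣m))) ⟩
  2               ∎
  where
  open ≡-Reasoning
  k∣m : k ∣ m
  k∣m = *-cancelʳ-∣ 2 (subst₂ _∣_ t≡k*2 (*-comm 2 m) t∣2m)

-- Multiplicative orders

module _ {q : ℕ} .{{_ : NonZero q}} {r : ℕ} where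

  private
    Period : ℕ → Set
    Period t = 0 < t × r ∣ q ^ t ∸ 1

    period? : ∀ t → Dec (Period t)
    period? t = (0 <? t) ×-dec (r ∣? q ^ t ∸ 1)

    1≤q^ : ∀ e → 1 ≤ q ^ e
    1≤q^ = m^n>0 q

    q^[2e] : ∀ e → + (q ^ (2 * e)) ≡ + (q ^ e) ℤ.* + (q ^ e)
    q^[2e] e = begin
      + (q ^ (2 * e))         ≡⟨ cong (λ k → + (q ^ k)) (*-comm 2 e) ⟩
      + (q ^ (e * 2))         ≡⟨ cong +_ (^-*-assoc q e 2) ⟨
      + ((q ^ e) ^ 2)         ≡⟨ cong (λ k → + (q ^ e * k)) (*-identityʳ (q ^ e)) ⟩
      + (q ^ e * q ^ e)       ≡⟨ ℤ.pos-* (q ^ e) (q ^ e) ⟩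
      + (q ^ e) ℤ.* + (q ^ e) ∎
      where open ≡-Reasoning

  multOrder⇒≡1 : ∀ {t} → IsMultOrder r q t → + (q ^ t) ≡ 1ℤ mod r
  multOrder⇒≡1 {t} (_ , r∣q^t-1 , _) = ∣∸⇒≡mod (1≤q^ t) r∣q^t-1

  multOrder-exists : ∀ {w} → 0 < w → + (q ^ w) ≡ 1ℤ mod r → ∃[ t ] IsMultOrder r q t
  multOrder-exists {w} 0<w q^w≡1 with least-witness period? (0<w , ≡mod⇒∣∸ (1≤q^ w) q^w≡1)
  ... | t , (0<t , r∣q^t-1) , least = t , 0<t , r∣q^t-1 , λ u 0<u r∣q^u-1 → least (0<u , r∣q^u-1)

  multOrder-∣ : ∀ {t w} → IsMultOrder r q t → + (q ^ w) ≡ 1ℤ mod r → t ∣ w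
  multOrder-∣ {t} {w} ord@(0<t , _ , least) q^w≡1 = m%n≡0⇒n∣m w t w%t≡0
    where
    instance
      t≢0 : NonZero t
      t≢0 = >-nonZero 0<t
    open ≡mod-Reasoning r
    q^[w%t]≡1 : + (q ^ (w % t)) ≡ 1ℤ mod r
    q^[w%t]≡1 = begin
      + (q ^ (w % t))                           ≡⟨ ℤ.*-identityʳ (+ (q ^ (w % t))) ⟨
      + (q ^ (w % t)) ℤ.* 1ℤ                    ≈⟨ *-congˡ-≡mod (+ (q ^ (w % t))) q^[w/t*t]≡1 ⟨
      + (q ^ (w % t)) ℤ.* + (q ^ (w / t * t))   ≡⟨ ℤ.pos-* (q ^ (w % t)) (q ^ (w / t * t)) ⟨
      + (q ^ (w % t) * q ^ (w / t * t))         ≡⟨ cong +_ (^-distribˡ-+-* q (w % t) (w / t * t)) ⟨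
      + (q ^ (w % t + w / t * t))               ≡⟨ cong (λ e → + (q ^ e)) (m≡m%n+[m/n]*n w t) ⟨
      + (q ^ w)                                 ≈⟨ q^w≡1 ⟩
      1ℤ                                        ∎
      where
      q^[w/t*t]≡1 : + (q ^ (w / t * t)) ≡ 1ℤ mod r
      q^[w/t*t]≡1 = ^≡1⇒^-multiple≡1 (multOrder⇒≡1 ord) (n∣m*n (w / t))
    w%t≡0 : w % t ≡ 0
    w%t≡0 with w % t | m%n<n w t | q^[w%t]≡1
    ... | zero  | _   | _     = refl
    ... | suc x | x<t | q^x≡1 =
      contradiction (least (suc x) z<s (≡mod⇒∣∸ (1≤q^ (suc x)) q^x≡1)) (<⇒≱ x<t)

  q^e≡-1⇒q^[2e]≡1 : ∀ e → + (q ^ e) ℤ.+ 1ℤ ≡ 0ℤ mod r → + (q ^ (2 * e)) ≡ 1ℤ mod r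
  q^e≡-1⇒q^[2e]≡1 e x+1≡0 = begin
    + (q ^ (2 * e))                       ≡⟨ q^[2e] e ⟩
    x ℤ.* x                               ≡⟨ complete x ⟩
    (x ℤ.+ 1ℤ) ℤ.* (x ℤ.- 1ℤ) ℤ.+ 1ℤ     ≈⟨ +-cong-≡mod (*-cong-≡mod x+1≡0 ≡mod-refl) ≡mod-refl ⟩
    0ℤ ℤ.* (x ℤ.- 1ℤ) ℤ.+ 1ℤ             ≡⟨⟩
    1ℤ                                    ∎
    where
    open ≡mod-Reasoning r
    x = + (q ^ e)
    complete : ∀ x → x ℤ.* x ≡ (x ℤ.+ 1ℤ) ℤ.* (x ℤ.- 1ℤ) ℤ.+ 1ℤ
    complete = solve-∀

  q^e≡-1⇒multOrder∤e : Prime r → r ≢ 2 → ∀ {e t} → + (q ^ e) ℤ.+ 1ℤ ≡ 0ℤ mod r →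
                        IsMultOrder r q t → ¬ t ∣ e
  q^e≡-1⇒multOrder∤e r-prime r≢2 {e} x+1≡0 ord t∣e =
    r≢2 (≤-antisym (∣⇒≤ (≡mod⇒∣∸ z≤n 2≡0)) (nonTrivial⇒n>1 r {{prime⇒nonTrivial r-prime}}))
    where
    open ≡mod-Reasoning r
    2≡0 : + 2 ≡ 0ℤ mod r
    2≡0 = begin
      1ℤ ℤ.+ 1ℤ          ≈⟨ +-cong-≡mod (^≡1⇒^-multiple≡1 (multOrder⇒≡1 ord) t∣e) (≡mod-refl {a = 1ℤ}) ⟨
      + (q ^ e) ℤ.+ 1ℤ   ≈⟨ x+1≡0 ⟩
      0ℤ                 ∎

  ∣q^odd+1⇒multOrder%4≡2 : Prime r → r ≢ 2 → ∀ a → r ∣ q ^ suc (2 * a) + 1 →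
                            ∃[ t ] (IsMultOrder r q t × t % 4 ≡ 2)
  ∣q^odd+1⇒multOrder%4≡2 r-prime r≢2 a r∣x+1 =
    let t , ord = multOrder-exists {w = 2 * suc (2 * a)} z<s x²≡1
    in  t , ord , ∣2m∧∤m⇒%4≡2 (multOrder-∣ ord x²≡1)
                    (q^e≡-1⇒multOrder∤e r-prime r≢2 x+1≡0 ord) (2∤odd a)
    where
    x+1≡0 : + (q ^ suc (2 * a)) ℤ.+ 1ℤ ≡ 0ℤ mod r
    x+1≡0 = ∣+1⇒+1≡0 r∣x+1
    x²≡1 : + (q ^ (2 * suc (2 * a))) ≡ 1ℤ mod r
    x²≡1 = q^e≡-1⇒q^[2e]≡1 (suc (2 * a)) x+1≡0

  multOrder≡2e⇒q^e≡-1 : Prime r → ∀ {e} → IsMultOrder r q (2 * e) → + (q ^ e) ℤ.+ 1ℤ ≡ 0ℤ mod r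
  multOrder≡2e⇒q^e≡-1 r-prime {e} ord@(0<2e , _ , least) =
    [ ⊥-elim ∘ q^e≢1 , id ]′ (x²≡1⇒x≡±1 r-prime (subst (_≡ 1ℤ mod r) (q^[2e] e) (multOrder⇒≡1 ord)))
    where
    0<e : 0 < e
    0<e = n≢0⇒n>0 (λ e≡0 → <⇒≱ 0<2e (≤-reflexive (cong (2 *_) e≡0)))
    e<2e : e < 2 * e
    e<2e = m<m+n e (subst (0 <_) (sym (*-identityˡ e)) 0<e)
    q^e≢1 : ¬ (+ (q ^ e) ≡ 1ℤ mod r)
    q^e≢1 q^e≡1 = <⇒≱ e<2e (least e 0<e (≡mod⇒∣∸ (1≤q^ e) q^e≡1))

  multOrder%4≡2⇒∣q^odd+1 : Prime r → ∀ {t} → IsMultOrder r q t → t % 4 ≡ 2 →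
                            ∃[ a ] r ∣ q ^ suc (2 * a) + 1
  multOrder%4≡2⇒∣q^odd+1 r-prime {t} ord t%4≡2 =
    t / 4 , +1≡0⇒∣+1 (multOrder≡2e⇒q^e≡-1 r-prime (subst (IsMultOrder r q) (%4≡2⇒≡2*odd t%4≡2) ord))

-- Cyclotomic cosets and splittings

module Cosets (n : ℕ) .{{_ : NonZero n}} (q : ℕ) where

  infix 8 Q^_

  Q^_ : ℕ → ℤ
  Q^ j = + ((q ^ 2) ^ j)

  infix 4 _∼_

  _∼_ : Fin n → Fin n → Set
  s ∼ s′ = ∃[ j ] s′ ≡ Q^ j · s

  ∼-trans : ∀ {s s′ s″} → s ∼ s′ → s′ ∼ s″ → s ∼ s″
  ∼-trans {s} (i , refl) (j , refl) =
    j + i , trans (·-assoc (Q^ j) (Q^ i) s) (cong (_· s) (sym (pos-^-+ (q ^ 2) j i)))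

  ∼-zero : ∀ {s s′} → s ∼ s′ → toℕ s ≡ 0 → toℕ s′ ≡ 0
  ∼-zero (j , refl) = ·-zeroʳ (Q^ j)

  Unpaired : ℤ → Set
  Unpaired b = ∀ s → toℕ s ≢ 0 → ¬ s ∼ b · s

  splitting⇒unpaired : ∀ b → GivesSplitting n q b → Unpaired b
  splitting⇒unpaired b
    (S₁ , S₂ , S₁-closed , S₂-closed , partition , disjoint , (S₁→S₂ , _) , (S₂→S₁ , _))
    s s≢0 (j , b·s≡Q^j·s)
    with Equivalence.to (partition s) s≢0
  ... | inj₁ s∈S₁ = disjoint (b · s) (subst (_∈ S₁) (sym b·s≡Q^j·s) (S₁-closed s s∈S₁ j) , S₁→S₂ s s∈S₁)
  ... | inj₂ s∈S₂ = disjoint (b · s) (S₂→S₁ s s∈S₂ , subst (_∈ S₂) (sym b·s≡Q^j·s) (S₂-closed s s∈S₂ j))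

  module _ (n⊥q : Coprime n q) where

    private
      period : ∃[ P ] (0 < P × Q^ P ≡ 1ℤ mod n)
      period = coprime⇒∃x^P≡1 (coprime-^ n⊥q 2)

      P : ℕ
      P = proj₁ period

      instance
        P≢0 : NonZero P
        P≢0 = >-nonZero (proj₁ (proj₂ period))

      Q^-multiple≡1 : ∀ {j} → P ∣ j → Q^ j ≡ 1ℤ mod n
      Q^-multiple≡1 = ^≡1⇒^-multiple≡1 (proj₂ (proj₂ period))

    Q^-mod-period : ∀ j s → Q^ j · s ≡ Q^ (j % P) · s
    Q^-mod-period j s = ·-congˡ (begin
      Q^ j                         ≡⟨ cong Q^_ (m≡m%n+[m/n]*n j P) ⟩
      Q^ (j % P + j / P * P)       ≡⟨ pos-^-+ (q ^ 2) (j % P) (j / P * P) ⟩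
      Q^ (j % P) ℤ.* Q^ (j / P * P) ≈⟨ *-congˡ-≡mod (Q^ (j % P)) (Q^-multiple≡1 (n∣m*n (j / P))) ⟩
      Q^ (j % P) ℤ.* 1ℤ            ≡⟨ ℤ.*-identityʳ (Q^ (j % P)) ⟩
      Q^ (j % P)                   ∎) s
      where open ≡mod-Reasoning n

    ∼-sym : ∀ {s s′} → s ∼ s′ → s′ ∼ s
    ∼-sym {s} (j , refl) = k , sym (begin
      Q^ k · Q^ j · s         ≡⟨ ·-assoc (Q^ k) (Q^ j) s ⟩
      (Q^ k ℤ.* Q^ j) · s     ≡⟨ cong (_· s) (pos-^-+ (q ^ 2) k j) ⟨
      Q^ (k + j) · s          ≡⟨ ·-congˡ (Q^-multiple≡1 P∣k+j) s ⟩
      1ℤ · s                  ≡⟨ ·-identityˡ s ⟩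
      s                       ∎)
      where
      open ≡-Reasoning
      k = pred P * j
      P∣k+j : P ∣ k + j
      P∣k+j = subst (P ∣_) (trans (cong (_* j) (sym (suc-pred P))) (+-comm j k)) (m∣m*n j)

    ∼-positive : ∀ {s s′} → s ∼ s′ → ∃[ j ] s′ ≡ Q^ suc j · s
    ∼-positive {s} (j , refl) = j + pred P , (begin
      Q^ j · s                   ≡⟨ Q^-mod-period j s ⟩
      Q^ (j % P) · s             ≡⟨ cong (λ e → Q^ e · s) ([m+kn]%n≡m%n j 1 P) ⟨
      Q^ ((j + 1 * P) % P) · s   ≡⟨ Q^-mod-period (j + 1 * P) s ⟨
      Q^ (j + 1 * P) · s         ≡⟨ cong (λ e → Q^ e · s) (j+P≡1+j+pred[P]) ⟩
      Q^ suc (j + pred P) · s    ∎)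
      where
      open ≡-Reasoning
      j+P≡1+j+pred[P] : j + 1 * P ≡ suc (j + pred P)
      j+P≡1+j+pred[P] =
        trans (cong (_+_ j) (trans (*-identityˡ P) (sym (suc-pred P)))) (+-suc j (pred P))

    leader : Fin n → ℕ
    leader s = minUpTo P (λ j → toℕ (Q^ j · s))

    leader-≤ : ∀ {s s′} → s ∼ s′ → leader s ≤ toℕ s′
    leader-≤ {s} (j , refl) = subst (leader s ≤_) (cong toℕ (sym (Q^-mod-period j s)))
      (minUpTo-≤ (λ j → toℕ (Q^ j · s)) (<⇒≤ (m%n<n j P)))

    leader-attained : ∀ s → ∃[ s′ ] (s ∼ s′ × leader s ≡ toℕ s′)
    leader-attained s with minUpTo-attained P (λ j → toℕ (Q^ j · s))
    ... | j , leader≡ = Q^ j · s , (j , refl) , leader≡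

    leader-resp-∼ : ∀ {s s′} → s ∼ s′ → leader s ≡ leader s′
    leader-resp-∼ s∼s′ = ≤-antisym (leader-mono s∼s′) (leader-mono (∼-sym s∼s′))
      where
      leader-mono : ∀ {s s′} → s ∼ s′ → leader s ≤ leader s′
      leader-mono {s′ = s′} s∼s′ with leader-attained s′
      ... | u , s′∼u , leader≡ = subst (_ ≤_) (sym leader≡) (leader-≤ (∼-trans s∼s′ s′∼u))

    leader≡⇒∼ : ∀ {s s′} → leader s ≡ leader s′ → s ∼ s′
    leader≡⇒∼ {s} {s′} leader≡ with leader-attained s | leader-attained s′
    ... | u , s∼u , leader[s]≡u | u′ , s′∼u′ , leader[s′]≡u′ =
      ∼-trans s∼u (subst (_∼ s′) u′≡u (∼-sym s′∼u′))
      where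
      u′≡u : u′ ≡ u
      u′≡u = toℕ-injective (trans (sym leader[s′]≡u′) (trans (sym leader≡) leader[s]≡u))

    module _ (b : ℤ) (c : ℕ) (b²≡Q^c : b ℤ.* b ≡ Q^ c mod n) where

      b·-Q^· : ∀ j s → b · Q^ j · s ≡ Q^ j · b · s
      b·-Q^· j s = begin
        b · Q^ j · s          ≡⟨ ·-assoc b (Q^ j) s ⟩
        (b ℤ.* Q^ j) · s      ≡⟨ cong (_· s) (ℤ.*-comm b (Q^ j)) ⟩
        (Q^ j ℤ.* b) · s      ≡⟨ ·-assoc (Q^ j) b s ⟨
        Q^ j · b · s          ∎
        where open ≡-Reasoning

      ∼-b·b· : ∀ s → s ∼ b · b · s
      ∼-b·b· s = c , trans (·-assoc b b s) (·-congˡ b²≡Q^c s)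

      b·-zero⇒zero : ∀ {s} → toℕ (b · s) ≡ 0 → toℕ s ≡ 0
      b·-zero⇒zero {s} b·s≡0 = ∼-zero (∼-sym (∼-b·b· s)) (·-zeroʳ b b·s≡0)

      b·-surjective : ∀ t → ∃[ s ] (b · s ≡ t × b · t ∼ s)
      b·-surjective t =
        let k , t≡Q^k·b·b·t = ∼-sym (∼-b·b· t)
        in  Q^ k · b · t , trans (b·-Q^· k (b · t)) (sym t≡Q^k·b·b·t) , (k , refl)

      module _ (unpaired : Unpaired b) where

        Half : Rel ℕ 0ℓ → Fin n → Set
        Half _R_ s = toℕ s ≢ 0 × leader s R leader (b · s)

        half? : ∀ {R} → Decidable R → ∀ s → Dec (Half R s)
        half? R? s = ¬? (toℕ s ≟ 0) ×-dec R? (leader s) (leader (b · s))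

        half-closed : ∀ {R} (R? : Decidable R) → UnionOfCosets n q (select (half? R?))
        half-closed {R} R? s s∈ j =
          let s≢0 , R[s] = ∈-select⁻ (half? R?) s∈
          in  ∈-select⁺ (half? R?)
                ( (λ Q^j·s≡0 → s≢0 (∼-zero (∼-sym (j , refl)) Q^j·s≡0))
                , subst₂ R (leader-resp-∼ (j , refl)) (leader-resp-∼ (j , b·-Q^· j s)) R[s] )

        half-maps : ∀ {R} (R? : Decidable R) →
                    MapsOnto n b (select (half? R?)) (select (half? (flip R?)))
        half-maps {R} R? = forward , backward
          where
          forward : ∀ s → s ∈ select (half? R?) → b · s ∈ select (half? (flip R?))
          forward s s∈ =
            let s≢0 , R[s] = ∈-select⁻ (half? R?) s∈
            in  ∈-select⁺ (half? (flip R?))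
                  ( s≢0 ∘ b·-zero⇒zero
                  , subst (λ l → R l (leader (b · s))) (leader-resp-∼ (∼-b·b· s)) R[s] )
          backward : ∀ t → t ∈ select (half? (flip R?)) → ∃[ s ] (s ∈ select (half? R?) × b · s ≡ t)
          backward t t∈ =
            let t≢0 , R[t]             = ∈-select⁻ (half? (flip R?)) t∈
                s , b·s≡t , b·t∼s     = b·-surjective t
            in  s , ∈-select⁺ (half? R?)
                      ( (λ s≡0 → t≢0 (subst (λ u → toℕ u ≡ 0) b·s≡t (·-zeroʳ b s≡0)))
                      , subst₂ R (leader-resp-∼ b·t∼s) (cong leader (sym b·s≡t)) R[t] )
                  , b·s≡t

        -- flip _<?_ and flip _>?_ reduce to _>?_ and _<?_, so half-maps yields both maps.
        unpaired⇒splitting : GivesSplitting n q b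
        unpaired⇒splitting = S₁ , S₂ , half-closed _<?_ , half-closed _>?_ , partition , disjoint
                           , half-maps _<?_ , half-maps _>?_
          where
          S₁ = select (half? _<?_)
          S₂ = select (half? _>?_)
          partition : ∀ i → (toℕ i ≢ 0 ⇔ (i ∈ S₁ ⊎ i ∈ S₂))
          partition i = mk⇔ split (λ { (inj₁ i∈S₁) → proj₁ (∈-select⁻ (half? _<?_) i∈S₁)
                                     ; (inj₂ i∈S₂) → proj₁ (∈-select⁻ (half? _>?_) i∈S₂) })
            where
            split : toℕ i ≢ 0 → i ∈ S₁ ⊎ i ∈ S₂
            split i≢0 with <-cmp (leader i) (leader (b · i))
            ... | tri< < _ _ = inj₁ (∈-select⁺ (half? _<?_) (i≢0 , <))
            ... | tri≈ _ ≡ _ = contradiction (leader≡⇒∼ ≡) (unpaired i i≢0)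
            ... | tri> _ _ > = inj₂ (∈-select⁺ (half? _>?_) (i≢0 , >))
          disjoint : ∀ i → ¬ (i ∈ S₁ × i ∈ S₂)
          disjoint i (i∈S₁ , i∈S₂) =
            <-asym (proj₂ (∈-select⁻ (half? _<?_) i∈S₁)) (proj₂ (∈-select⁻ (half? _>?_) i∈S₂))

      splitting⇔unpaired : GivesSplitting n q b ⇔ Unpaired b
      splitting⇔unpaired = mk⇔ (splitting⇒unpaired b) unpaired⇒splitting

  -- The multiplier -q

  -q : ℤ
  -q = ℤ.- + q

  private
    Q^[1+a]≡q*q^odd : ∀ a → Q^ suc a ≡ + q ℤ.* + (q ^ suc (2 * a))
    Q^[1+a]≡q*q^odd a = begin
      + ((q ^ 2) ^ suc a)              ≡⟨ cong +_ (^-*-assoc q 2 (suc a)) ⟩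
      + (q ^ (2 * suc a))              ≡⟨ cong (λ e → + (q ^ e)) (*-suc 2 a) ⟩
      + (q * q ^ suc (2 * a))          ≡⟨ ℤ.pos-* q (q ^ suc (2 * a)) ⟩
      + q ℤ.* + (q ^ suc (2 * a))      ∎
      where open ≡-Reasoning

    -- Both sides are differences, so that ≡mod-resp-diff can transport congruences along it.
    pairing-identity : ∀ a x → Q^ suc a ℤ.* x ℤ.- -q ℤ.* x
                               ≡ + q ℤ.* ((+ (q ^ suc (2 * a)) ℤ.+ 1ℤ) ℤ.* x) ℤ.- 0ℤ
    pairing-identity a x = trans (cong (λ y → y ℤ.* x ℤ.- -q ℤ.* x) (Q^[1+a]≡q*q^odd a))
                                 (factor (+ q) (+ (q ^ suc (2 * a))) x)
      where
      factor : ∀ q X x → q ℤ.* X ℤ.* x ℤ.- ℤ.- q ℤ.* x ≡ q ℤ.* ((X ℤ.+ 1ℤ) ℤ.* x) ℤ.- 0ℤ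
      factor = solve-∀

    pos-[X+1]*s : ∀ X s → + ((X + 1) * s) ≡ (+ X ℤ.+ 1ℤ) ℤ.* + s
    pos-[X+1]*s X s = trans (ℤ.pos-* (X + 1) s) (cong (ℤ._* + s) (ℤ.pos-+ X 1))

  ∣⇒-q·s≡Q^[1+a]·s : ∀ {a s} → n ∣ (q ^ suc (2 * a) + 1) * toℕ s → -q · s ≡ Q^ suc a · s
  ∣⇒-q·s≡Q^[1+a]·s {a} {s} n∣ = ≡mod⇒·≡· {a = -q} {a′ = Q^ suc a} s
    (≡mod-sym (≡mod-resp-diff (sym (pairing-identity a (toℤ s))) q*[X+1]*s≡0))
    where
    [X+1]*s≡0 : (+ (q ^ suc (2 * a)) ℤ.+ 1ℤ) ℤ.* toℤ s ≡ 0ℤ mod n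
    [X+1]*s≡0 = subst (_≡ 0ℤ mod n) (pos-[X+1]*s (q ^ suc (2 * a)) (toℕ s)) (∣∸⇒≡mod z≤n n∣)
    q*[X+1]*s≡0 : + q ℤ.* ((+ (q ^ suc (2 * a)) ℤ.+ 1ℤ) ℤ.* toℤ s) ≡ 0ℤ mod n
    q*[X+1]*s≡0 = ≡mod-trans (*-congˡ-≡mod (+ q) [X+1]*s≡0) (≡⇒≡mod (ℤ.*-zeroʳ (+ q)))

  -q·s≡Q^[1+a]·s⇒∣ : Coprime n q → ∀ {a s} → -q · s ≡ Q^ suc a · s →
                     n ∣ (q ^ suc (2 * a) + 1) * toℕ s
  -q·s≡Q^[1+a]·s⇒∣ n⊥q {a} {s} eq = ≡mod⇒∣∸ z≤n
    (subst (_≡ 0ℤ mod n) (sym (pos-[X+1]*s (q ^ suc (2 * a)) (toℕ s)))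
      (*-cancelˡ-≡mod n⊥q q*[X+1]*s≡q*0))
    where
    q*[X+1]*s≡q*0 : + q ℤ.* ((+ (q ^ suc (2 * a)) ℤ.+ 1ℤ) ℤ.* toℤ s) ≡ + q ℤ.* 0ℤ mod n
    q*[X+1]*s≡q*0 = ≡mod-trans
      (≡mod-resp-diff (pairing-identity a (toℤ s)) (≡mod-sym (·≡·⇒≡mod {a = -q} {a′ = Q^ suc a} s eq)))
      (≡⇒≡mod (sym (ℤ.*-zeroʳ (+ q))))

  -q²≡Q : -q ℤ.* -q ≡ Q^ 1 mod n
  -q²≡Q = ≡⇒≡mod (begin
    -q ℤ.* -q          ≡⟨ neg*neg (+ q) ⟩
    + q ℤ.* + q        ≡⟨ ℤ.pos-* q q ⟨
    + (q * q)          ≡⟨ cong +_ (square q) ⟩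
    Q^ 1               ∎)
    where
    open ≡-Reasoning
    neg*neg : ∀ x → ℤ.- x ℤ.* ℤ.- x ≡ x ℤ.* x
    neg*neg = solve-∀
    square : ∀ q → q * q ≡ (q ^ 2) ^ 1
    square q = sym (trans (^-identityʳ (q ^ 2)) (cong (q *_) (*-identityʳ q)))

  ∣q^odd+1⇒paired : ∀ {r} → Prime r → r ∣ n → ∀ a → r ∣ q ^ suc (2 * a) + 1 →
                    ∃[ s ] (toℕ s ≢ 0 × s ∼ -q · s)
  ∣q^odd+1⇒paired {r} r-prime (divides m n≡m*r) a r∣X+1 =
    s , m≢0 ∘ trans (sym toℕ[s]≡m) , suc a , ∣⇒-q·s≡Q^[1+a]·s {a} {s} n∣[X+1]*s
    where
    m≢0 : m ≢ 0
    m≢0 m≡0 = ≢-nonZero⁻¹ n (trans n≡m*r (cong (_* r) m≡0))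
    m<n : m < n
    m<n = subst (m <_) (sym n≡m*r)
            (m<m*n m r {{≢-nonZero m≢0}} (nonTrivial⇒n>1 r {{prime⇒nonTrivial r-prime}}))
    s : Fin n
    s = fromℕ< m<n
    toℕ[s]≡m : toℕ s ≡ m
    toℕ[s]≡m = toℕ-fromℕ< m<n
    n∣[X+1]*s : n ∣ (q ^ suc (2 * a) + 1) * toℕ s
    n∣[X+1]*s = subst₂ _∣_ (sym (trans n≡m*r (*-comm m r)))
                  (cong ((q ^ suc (2 * a) + 1) *_) (sym toℕ[s]≡m)) (*-monoˡ-∣ m r∣X+1)

  paired⇒∣q^odd+1 : Coprime n q → ∀ {s} → toℕ s ≢ 0 → s ∼ -q · s →
                    ∃[ r ] (Prime r × r ∣ n × ∃[ a ] r ∣ q ^ suc (2 * a) + 1)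
  paired⇒∣q^odd+1 n⊥q {s} s≢0 s∼-q·s =
    let a , -q·s≡Q^[1+a]·s       = ∼-positive n⊥q s∼-q·s
        n∣[X+1]*s                 = -q·s≡Q^[1+a]·s⇒∣ n⊥q {a} {s} -q·s≡Q^[1+a]·s
        r , r-prime , r∣n , r∣X+1 = common-prime-factor {m = q ^ suc (2 * a) + 1} n∣[X+1]*s
                                      (n≢0⇒n>0 s≢0) (toℕ<n s)
    in  r , r-prime , r∣n , a , r∣X+1

  unpaired[-q]⇔multOrders%4≢2 : .{{_ : NonZero q}} → n % 2 ≡ 1 → Coprime n q →
    Unpaired -q ⇔ (∀ r → Prime r → r ∣ n → ∀ t → IsMultOrder r q t → t % 4 ≢ 2)
  unpaired[-q]⇔multOrders%4≢2 n-odd n⊥q = mk⇔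
    (λ unpaired r r-prime r∣n t ord t%4≡2 →
      let a , r∣X+1          = multOrder%4≡2⇒∣q^odd+1 r-prime ord t%4≡2
          s , s≢0 , s∼-q·s   = ∣q^odd+1⇒paired r-prime r∣n a r∣X+1
      in  unpaired s s≢0 s∼-q·s)
    (λ orders%4≢2 s s≢0 s∼-q·s →
      let r , r-prime , r∣n , a , r∣X+1 = paired⇒∣q^odd+1 n⊥q s≢0 s∼-q·s
          r≢2 r≡2                       = %2≡1⇒2∤ n-odd (subst (_∣ n) r≡2 r∣n)
          t , ord , t%4≡2               = ∣q^odd+1⇒multOrder%4≡2 r-prime r≢2 a r∣X+1
      in  orders%4≢2 r r-prime r∣n t ord t%4≡2)

theorem5p1 : (p q n : ℕ) .{{_ : NonZero n}} → IsPrimePowerOf p q → n % 2 ≡ 1 → gcd n q ≡ 1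
    → GivesSplitting n q (- (+ q))
      ⇔ (∀ (r : ℕ) → Prime r → r ∣ n → ∀ (t : ℕ) → IsMultOrder r q t → t % 4 ≢ 2)
theorem5p1 p q n (p-prime , k , _ , q≡p^k) n-odd gcd[n,q]≡1 =
  ⇔-trans (splitting⇔unpaired n⊥q -q 1 -q²≡Q) (unpaired[-q]⇔multOrders%4≢2 n-odd n⊥q)
  where
  open Cosets n q
  n⊥q : Coprime n q
  n⊥q = gcd≡1⇒coprime gcd[n,q]≡1
  -- The only use of the prime-power hypothesis.
  instance
    q≢0 : NonZero q
    q≢0 = subst NonZero (sym q≡p^k) (m^n≢0 p k {{prime⇒nonZero p-prime}})
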